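{- Let $p$ be a prime and $r\ge1$. Let $l_1,l_2,l_3$ be affine functions on $\mathbb{F}_{p^r}$ with $l_1$ and $l_2$ permutations, let $d(x)$ be a Dembowski–Ostrom polynomial over $\mathbb{F}_{p^r}$, and let $A(x)$ be an Alltop polynomial on $\mathbb{F}_{p^r}$. Put $A'(x)=l_1\circ A\circ l_2(x)+d(x)+l_3(x)$. Then $A'(x)$ is an Alltop polynomial, and for every $a\in\mathbb{F}_{p^r}^*$ there exists $b\in\mathbb{F}_{p^r}^*$ such that $\Delta_{A,a}(x)$ is EA-equivalent to $\Delta_{A',b}(x)$.
   Context: For $f:\mathbb{F}_{p^r}\to\mathbb{F}_{p^r}$ and $a\in\mathbb{F}_{p^r}$ put $\Delta_{f,a}(x)=f(x+a)-f(x)$. A function $f$ is planar if $\Delta_{f,a}$ is a bijection for every $a\in\mathbb{F}_{p^r}^*$; $A$ is an Alltop polynomial if $\Delta_{A,a}$ is planar for every $a\in\mathbb{F}_{p^r}^*$. An additive function satisfies $L(x+y)=L(x)+L(y)$; an affine function is an additive function plus a constant. A Dembowski–Ostrom polynomial has the form $\sum_{i,j=0}^{r-1}a_{ij}x^{p^i+p^j}$. Two functions $f_1,f_2$ are extended affine (EA) equivalent if there are affine functions $m_1,m_2,m_3$ with $m_1,m_2$ permutations such that $f_1=m_1\circ f_2\circ m_2+m_3$. -}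

module Defs where

open import Data.Nat using (ℕ; zero; suc) renaming (_^_ to _^ℕ_; _+_ to _+ℕ_)
open import Data.Fin using (Fin; zero; suc)
open import Data.Product using (Σ; ∃; _×_; _,_)
open import Relation.Binary.PropositionalEquality using (_≡_; _≢_)
open import Algebra.Core using (Op₁; Op₂)
open import Algebra.Structures using (IsCommutativeRing)
open import Function.Bundles using (_↔_)
open import Function.Definitions using (Bijective)

record FiniteField (p r : ℕ) : Set₁ where
  infixl 6 _+_ _-_
  infixl 7 _*_
  field
    Carrier : Set
    _+_ _*_ : Op₂ Carrier
    -_      : Op₁ Carrier
    0# 1#   : Carrier
    isCommutativeRing : IsCommutativeRing _≡_ _+_ _*_ -_ 0# 1#
    0≢1     : 0# ≢ 1#
    inverse : ∀ x → x ≢ 0# → ∃ λ y → x * y ≡ 1#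
    enumeration : Fin (p ^ℕ r) ↔ Carrier

  _-_ : Op₂ Carrier
  x - y = x + (- y)

  _^_ : Carrier → ℕ → Carrier
  x ^ zero  = 1#
  x ^ suc n = x * (x ^ n)

  sumFin : (n : ℕ) → (Fin n → Carrier) → Carrier
  sumFin zero    f = 0#
  sumFin (suc n) f = f zero + sumFin n (λ i → f (suc i))

  Δ : (Carrier → Carrier) → Carrier → Carrier → Carrier
  Δ f a x = f (x + a) - f x

  IsBijection : (Carrier → Carrier) → Set
  IsBijection f = Bijective _≡_ _≡_ f

  Planar : (Carrier → Carrier) → Set
  Planar f = ∀ a → a ≢ 0# → IsBijection (Δ f a)

  Alltop : (Carrier → Carrier) → Set
  Alltop A = ∀ a → a ≢ 0# → Planar (Δ A a)

  Additive : (Carrier → Carrier) → Set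
  Additive L = ∀ x y → L (x + y) ≡ L x + L y

  Affine : (Carrier → Carrier) → Set
  Affine f = Σ (Carrier → Carrier) λ L → Additive L × ∃ λ c → ∀ x → f x ≡ L x + c

  DembowskiOstrom : (Carrier → Carrier) → Set
  DembowskiOstrom d =
    Σ (Fin r → Fin r → Carrier) λ a →
      ∀ x → d x ≡ sumFin r (λ i → sumFin r (λ j →
              a i j * (x ^ ((p ^ℕ Data.Fin.toℕ i) +ℕ (p ^ℕ Data.Fin.toℕ j)))))

  EAEquivalent : (Carrier → Carrier) → (Carrier → Carrier) → Set
  EAEquivalent f₁ f₂ =
    Σ (Carrier → Carrier) λ m₁ → Σ (Carrier → Carrier) λ m₂ → Σ (Carrier → Carrier) λ m₃ →
      Affine m₁ × IsBijection m₁ × Affine m₂ × IsBijection m₂ × Affine m₃ ×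
      (∀ x → f₁ x ≡ m₁ (f₂ (m₂ x)) + m₃ x)

-- Write A′ = l₁ ∘ A ∘ l₂ + E with E = d + l₃. Every derivative of E is affine: for d because
-- F has characteristic p (translation by 1 permutes the p ^ r elements, so p ^ r · 1 = 0), which
-- makes x ↦ x ^ p ^ i additive and each x ^ (p ^ i + p ^ j) a product of two additive maps.
-- Hence Δ A′ b = L₁ ∘ Δ A (L₂ b) ∘ l₂ + (affine), where L₁, L₂ are the additive parts of l₁, l₂:
-- the two derivatives are EA-equivalent. A further derivative only turns the affine error into a
-- constant, so planarity transfers and A′ is Alltop; for a given a take b = L₂⁻¹ a.

module Submission where

open import Level using (Level)
open import Defs
import Data.Nat as Nat
open Nat using (ℕ; zero; suc; _≤_; _<_; s≤s; z≤n)
import Data.Nat.Properties as ℕₚ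
open import Data.Nat.Combinatorics using (_C_; nCn≡1; nC1≡n; k>n⇒nCk≡0; nCk+nC[k+1]≡[n+1]C[k+1])
open import Data.Nat.Divisibility using (_∣_; divides; ∣⇒≤)
open import Data.Nat.Primality using (Prime; euclidsLemma)
open import Data.Fin as Fin using (Fin; zero; suc; toℕ; fromℕ)
open import Data.Fin.Properties using (toℕ-fromℕ; inject₁ℕ<)
open import Data.Sum using (inj₁; inj₂)
open import Data.Product using (∃; _×_; _,_; proj₁; proj₂)
open import Data.Vec.Functional using (tail; init; last)
open import Data.Empty using (⊥-elim)
open import Function.Base using (_∘_)
open import Function.Bundles using (Inverse; _↔_; mk↔ₛ′)
open import Function.Definitions using (Bijective; Injective; StrictlyInverseˡ; StrictlyInverseʳ)
import Function.Construct.Composition as Composition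
open import Function.Consequences.Propositional
  using (inverseᵇ⇒bijective; strictlyInverseˡ⇒inverseˡ; strictlyInverseʳ⇒inverseʳ)
open import Function.Properties.Inverse using (↔-sym; ↔-trans; ↔⇒↣)
open import Relation.Binary.Definitions using (DecidableEquality)
open import Relation.Binary.PropositionalEquality
  using (_≡_; _≢_; _≗_; refl; sym; trans; cong; cong₂; subst; module ≡-Reasoning)
open import Relation.Nullary using (contradiction)
open import Relation.Nullary.Decidable using (yes; no; via-injection)
import Algebra.Bundles
open Algebra.Bundles using (CommutativeSemiring; CommutativeRing)
open import Algebra.Structures using (IsCommutativeRing)

[1+k]*[1+n]C[1+k]≡[1+n]*nCk : ∀ n k → suc k Nat.* (suc n C suc k) ≡ suc n Nat.* (n C k)
[1+k]*[1+n]C[1+k]≡[1+n]*nCk zero zero = refl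
[1+k]*[1+n]C[1+k]≡[1+n]*nCk zero (suc k)
  rewrite k>n⇒nCk≡0 {1} {suc (suc k)} (s≤s (s≤s z≤n)) | k>n⇒nCk≡0 {0} {suc k} (s≤s z≤n) = ℕₚ.*-zeroʳ (suc (suc k))
[1+k]*[1+n]C[1+k]≡[1+n]*nCk (suc n) zero
  rewrite nC1≡n (suc (suc n)) = trans (ℕₚ.+-identityʳ _) (sym (ℕₚ.*-identityʳ _))
[1+k]*[1+n]C[1+k]≡[1+n]*nCk (suc n) (suc k) = begin
  2+k Nat.* (2+n C 2+k)
    ≡⟨ cong (2+k Nat.*_) (sym (nCk+nC[k+1]≡[n+1]C[k+1] (suc n) (suc k))) ⟩
  2+k Nat.* (a + b)
    ≡⟨ ℕₚ.*-distribˡ-+ 2+k a b ⟩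
  2+k Nat.* a + 2+k Nat.* b
    ≡⟨ cong (2+k Nat.* a +_) ([1+k]*[1+n]C[1+k]≡[1+n]*nCk n (suc k)) ⟩
  (a + suc k Nat.* a) + suc n Nat.* (n C suc k)
    ≡⟨ cong (λ z → (a + z) + suc n Nat.* (n C suc k)) ([1+k]*[1+n]C[1+k]≡[1+n]*nCk n k) ⟩
  (a + suc n Nat.* (n C k)) + suc n Nat.* (n C suc k)
    ≡⟨ ℕₚ.+-assoc a _ _ ⟩
  a + (suc n Nat.* (n C k) + suc n Nat.* (n C suc k))
    ≡⟨ cong (a +_) (sym (ℕₚ.*-distribˡ-+ (suc n) (n C k) (n C suc k))) ⟩
  a + suc n Nat.* (n C k + n C suc k)
    ≡⟨ cong (λ z → a + suc n Nat.* z) (nCk+nC[k+1]≡[n+1]C[k+1] n k) ⟩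
  a + suc n Nat.* a
    ∎
  where
  open ≡-Reasoning
  open Nat using (_+_)
  2+k = suc (suc k)
  2+n = suc (suc n)
  a = suc n C suc k
  b = suc n C suc (suc k)

p∣pCk : ∀ {p k} → Prime p → 0 < k → k < p → p ∣ p C k
p∣pCk {suc n} {suc k} pr _ k<p
  with euclidsLemma (suc k) (suc n C suc k) pr
         (divides (n C k) (trans ([1+k]*[1+n]C[1+k]≡[1+n]*nCk n k) (ℕₚ.*-comm (suc n) (n C k))))
... | inj₁ p∣1+k = contradiction (∣⇒≤ p∣1+k) (ℕₚ.<⇒≱ k<p)
... | inj₂ p∣pCk = p∣pCk

module FreshmansDream {c ℓ} (S : CommutativeSemiring c ℓ) where
  open CommutativeSemiring S hiding (zero; refl; sym) renaming (trans to ≈-trans)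
  open import Algebra.Properties.Semiring.Mult semiring
    using (×-congʳ; ×-assoc-*; ×-assocˡ; ×-homo-1) renaming (_×_ to _·_)
  open import Algebra.Properties.Semiring.Exp semiring
  open import Algebra.Properties.Semiring.Sum semiring using (sum; sum-init-last; sum-cong-≋; sum-replicate-zero)
  open import Algebra.Properties.CommutativeSemiring.Binomial S using (binomialTerm) renaming (theorem to binomial-theorem)
  open import Relation.Binary.Reasoning.Setoid setoid

  p·x≈0 : ∀ {p} → p · 1# ≈ 0# → ∀ x → p · x ≈ 0#
  p·x≈0 {p} p·1≈0 x = begin
    p · x          ≈⟨ ×-congʳ p (*-identityˡ x) ⟨
    p · (1# * x)   ≈⟨ ×-assoc-* p 1# x ⟨
    (p · 1#) * x   ≈⟨ *-congʳ p·1≈0 ⟩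
    0# * x         ≈⟨ zeroˡ x ⟩
    0#             ∎

  p∣m⇒m·x≈0 : ∀ {p m} → p · 1# ≈ 0# → ∀ x → p ∣ m → m · x ≈ 0#
  p∣m⇒m·x≈0 {p} p·1≈0 x (divides q refl) = begin
    (q Nat.* p) · x  ≡⟨ cong (_· x) (ℕₚ.*-comm q p) ⟩
    (p Nat.* q) · x  ≈⟨ ×-assocˡ x p q ⟨
    p · (q · x)      ≈⟨ p·x≈0 {p} p·1≈0 (q · x) ⟩
    0#               ∎

  binomialTerm-last : ∀ n x y → binomialTerm x y n (fromℕ n) ≈ x ^ n
  binomialTerm-last n x y rewrite toℕ-fromℕ n | nCn≡1 n | ℕₚ.n∸n≡0 n = begin
    1 · (x ^ n * 1#)  ≈⟨ ×-homo-1 _ ⟩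
    x ^ n * 1#        ≈⟨ *-identityʳ _ ⟩
    x ^ n             ∎

  ^p-distrib-+ : ∀ {p} → Prime p → p · 1# ≈ 0# → ∀ x y → (x + y) ^ p ≈ x ^ p + y ^ p
  ^p-distrib-+ {suc n} pr p·1≈0 x y = begin
    (x + y) ^ p                                         ≈⟨ binomial-theorem p x y ⟩
    t Fin.zero + sum (tail t)                           ≈⟨ +-congˡ (sum-init-last (tail t)) ⟩
    t Fin.zero + (sum (init (tail t)) + last (tail t))  ≈⟨ +-cong first (+-cong middle (binomialTerm-last p x y)) ⟩
    y ^ p + (0# + x ^ p)                                ≈⟨ +-congˡ (+-identityˡ _) ⟩
    y ^ p + x ^ p                                       ≈⟨ +-comm _ _ ⟩
    x ^ p + y ^ p                                       ∎
    where
    p = suc n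
    t = binomialTerm x y p
    first : t Fin.zero ≈ y ^ p
    first = ≈-trans (×-homo-1 _) (*-identityˡ _)
    middle : sum (init (tail t)) ≈ 0#
    middle = ≈-trans (sum-cong-≋ (λ i → p∣m⇒m·x≈0 p·1≈0 _ (p∣pCk pr (s≤s z≤n) (s≤s (inject₁ℕ< i)))))
                     (sum-replicate-zero n)

  ^p^i-distrib-+ : ∀ {p} → Prime p → p · 1# ≈ 0# →
                   ∀ i x y → (x + y) ^ (p Nat.^ i) ≈ x ^ (p Nat.^ i) + y ^ (p Nat.^ i)
  ^p^i-distrib-+ pr p·1≈0 zero x y = begin
    (x + y) * 1#     ≈⟨ *-identityʳ _ ⟩
    x + y            ≈⟨ +-cong (*-identityʳ x) (*-identityʳ y) ⟨
    x * 1# + y * 1#  ∎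
  ^p^i-distrib-+ {p} pr p·1≈0 (suc i) x y = begin
    (x + y) ^ (p Nat.* q)              ≈⟨ ^-assocʳ (x + y) p q ⟨
    ((x + y) ^ p) ^ q                  ≈⟨ ^-congˡ q (^p-distrib-+ pr p·1≈0 x y) ⟩
    (x ^ p + y ^ p) ^ q                ≈⟨ ^p^i-distrib-+ pr p·1≈0 i (x ^ p) (y ^ p) ⟩
    (x ^ p) ^ q + (y ^ p) ^ q          ≈⟨ +-cong (^-assocʳ x p q) (^-assocʳ y p q) ⟩
    x ^ (p Nat.* q) + y ^ (p Nat.* q)  ∎
    where q = p Nat.^ i

private
  variable
    ℓ₁ ℓ₂ ℓ₃ : Level
    A : Set ℓ₁
    B : Set ℓ₂
    C : Set ℓ₃

strictlyInverseᵇ⇒bijective : ∀ {f : A → B} {g : B → A} →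
  StrictlyInverseˡ _≡_ f g → StrictlyInverseʳ _≡_ f g → Bijective _≡_ _≡_ f
strictlyInverseᵇ⇒bijective {f = f} l r =
  inverseᵇ⇒bijective (strictlyInverseˡ⇒inverseˡ f l , strictlyInverseʳ⇒inverseʳ f r)

bijective-≗ : ∀ {f g : A → B} → f ≗ g → Bijective _≡_ _≡_ g → Bijective _≡_ _≡_ f
bijective-≗ f≗g (g-inj , g-sur) =
  (λ fx≡fy → g-inj (trans (sym (f≗g _)) (trans fx≡fy (f≗g _)))) ,
  λ y → proj₁ (g-sur y) , λ { refl → trans (f≗g _) (proj₂ (g-sur y) refl) }

∘-bijective : ∀ {f : B → C} {g : A → B} →
  Bijective _≡_ _≡_ f → Bijective _≡_ _≡_ g → Bijective _≡_ _≡_ (f ∘ g)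
∘-bijective f-bij g-bij = Composition.bijective _≡_ _≡_ _≡_ g-bij f-bij

module _ {f : A → B} (f-bij : Bijective _≡_ _≡_ f) where

  invert : B → A
  invert y = proj₁ (proj₂ f-bij y)

  invert-strictlyInverseˡ : StrictlyInverseˡ _≡_ f invert
  invert-strictlyInverseˡ y = proj₂ (proj₂ f-bij y) refl

  invert-strictlyInverseʳ : StrictlyInverseʳ _≡_ f invert
  invert-strictlyInverseʳ x = proj₁ f-bij (invert-strictlyInverseˡ (f x))

  invert-bijective : Bijective _≡_ _≡_ invert
  invert-bijective = strictlyInverseᵇ⇒bijective invert-strictlyInverseʳ invert-strictlyInverseˡ

module FiniteFieldProperties {p r : ℕ} (F : FiniteField p r) where
  open FiniteField F

  private
    R : CommutativeRing _ _
    R = record { isCommutativeRing = isCommutativeRing }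

  open CommutativeRing R
    using ( +-identityʳ; +-identityˡ; +-comm; +-assoc; -‿inverseʳ; -‿inverseˡ
          ; *-identityˡ; *-assoc; *-comm; zeroʳ; distribˡ
          ; +-group; +-abelianGroup; +-commutativeSemigroup; +-commutativeMonoid
          ; ring; semiring; commutativeSemiring )
  open import Algebra.Properties.Group +-group using (inverseʳ-unique; identityʳ-unique)
  open import Algebra.Properties.Ring ring using (-1*x≈-x)
  open import Algebra.Properties.RingWithoutOne (Algebra.Bundles.Ring.ringWithoutOne ring)
    using (x+x≈x⇒x≈0; x[y-z]≈xy-xz)
  open import Algebra.Properties.Semiring.Mult semiring using (×1-homo-*) renaming (_×_ to _·_)
  open import Algebra.Properties.Semiring.Exp semiring using () renaming (_^_ to _^ᴿ_)
  import Algebra.Properties.Semiring.Exp semiring as Exp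
  open import Algebra.Properties.CommutativeMonoid.Sum +-commutativeMonoid
    using (sum; sum-permute; sum-cong-≗; ∑-distrib-+; sum-replicate)
  open import Algebra.Properties.AbelianGroup +-abelianGroup using (⁻¹-∙-comm)
  open import Algebra.Properties.CommutativeSemigroup +-commutativeSemigroup using (interchange; xy∙z≈xz∙y)
  open import Algebra.Solver.Ring.NaturalCoefficients.Default commutativeSemiring
    using (solve; _:=_; _:+_; _:*_)
  open ≡-Reasoning

  private
    variable
      f g L : Carrier → Carrier

  x+[y-y]≡x : ∀ x y → x + (y - y) ≡ x
  x+[y-y]≡x x y = trans (cong (x +_) (-‿inverseʳ y)) (+-identityʳ x)

  [x+y]-y≡x : ∀ x y → (x + y) - y ≡ x
  [x+y]-y≡x x y = trans (+-assoc x y (- y)) (x+[y-y]≡x x y)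

  [a+b]-[c+d]≡[a-c]+[b-d] : ∀ a b c d → (a + b) - (c + d) ≡ (a - c) + (b - d)
  [a+b]-[c+d]≡[a-c]+[b-d] a b c d =
    trans (cong ((a + b) +_) (sym (⁻¹-∙-comm c d))) (interchange a b (- c) (- d))

  additive-0# : Additive L → L 0# ≡ 0#
  additive-0# {L} L-add = x+x≈x⇒x≈0 (L 0#) (trans (sym (L-add 0# 0#)) (cong L (+-identityʳ 0#)))

  additive-‿ : Additive L → ∀ x → L (- x) ≡ - L x
  additive-‿ {L} L-add x = inverseʳ-unique (L x) (L (- x)) (begin
    L x + L (- x)  ≡⟨ L-add x (- x) ⟨
    L (x - x)      ≡⟨ cong L (-‿inverseʳ x) ⟩
    L 0#           ≡⟨ additive-0# L-add ⟩
    0#             ∎)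

  additive⇒affine : Additive L → Affine L
  additive⇒affine {L} L-add = L , L-add , 0# , λ x → sym (+-identityʳ (L x))

  additive-sub : Additive L → ∀ x y → L (x - y) ≡ L x - L y
  additive-sub {L} L-add x y = trans (L-add x (- y)) (cong (L x +_) (additive-‿ L-add y))

  linear : Affine f → Carrier → Carrier
  linear = proj₁

  linear-additive : (f-aff : Affine f) → Additive (linear f-aff)
  linear-additive = proj₁ ∘ proj₂

  affine-shift : (f-aff : Affine f) → ∀ x a → f (x + a) ≡ f x + linear f-aff a
  affine-shift {f} (L , L-add , c , f≗) x a = begin
    f (x + a)          ≡⟨ f≗ (x + a) ⟩
    L (x + a) + c      ≡⟨ cong (_+ c) (L-add x a) ⟩
    L x + L a + c      ≡⟨ xy∙z≈xz∙y (L x) (L a) c ⟩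
    (L x + c) + L a    ≡⟨ cong (_+ L a) (f≗ x) ⟨
    f x + L a          ∎

  affine-sub : (f-aff : Affine f) → ∀ x y → f x - f y ≡ linear f-aff (x - y)
  affine-sub {f} (L , L-add , c , f≗) x y = begin
    f x - f y              ≡⟨ cong₂ _-_ (f≗ x) (f≗ y) ⟩
    (L x + c) - (L y + c)  ≡⟨ [a+b]-[c+d]≡[a-c]+[b-d] (L x) c (L y) c ⟩
    L x - L y + (c - c)    ≡⟨ x+[y-y]≡x (L x - L y) c ⟩
    L x - L y              ≡⟨ additive-sub L-add x y ⟨
    L (x - y)              ∎

  affine-Δ : (f-aff : Affine f) → ∀ a x → Δ f a x ≡ linear f-aff a
  affine-Δ {f} f-aff a x = begin
    f (x + a) - f x                  ≡⟨ cong (_- f x) (affine-shift f-aff x a) ⟩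
    (f x + linear f-aff a) - f x     ≡⟨ cong (_- f x) (+-comm (f x) (linear f-aff a)) ⟩
    (linear f-aff a + f x) - f x     ≡⟨ [x+y]-y≡x (linear f-aff a) (f x) ⟩
    linear f-aff a                   ∎

  affine-≗ : f ≗ g → Affine g → Affine f
  affine-≗ f≗g (L , L-add , c , g≗) = L , L-add , c , λ x → trans (f≗g x) (g≗ x)

  affine-const : ∀ c → Affine (λ _ → c)
  affine-const c = (λ _ → 0#) , (λ _ _ → sym (+-identityʳ 0#)) , c , λ _ → sym (+-identityˡ c)

  affine-+ : Affine f → Affine g → Affine (λ x → f x + g x)
  affine-+ (L , L-add , c , f≗) (M , M-add , d , g≗) =
    (λ x → L x + M x) ,
    (λ x y → trans (cong₂ _+_ (L-add x y) (M-add x y)) (interchange (L x) (L y) (M x) (M y))) ,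
    c + d ,
    λ x → trans (cong₂ _+_ (f≗ x) (g≗ x)) (interchange (L x) c (M x) d)

  affine-scale : ∀ k → Affine f → Affine (λ x → k * f x)
  affine-scale k (L , L-add , c , f≗) =
    (λ x → k * L x) , (λ x y → trans (cong (k *_) (L-add x y)) (distribˡ k (L x) (L y))) ,
    k * c , λ x → trans (cong (k *_) (f≗ x)) (distribˡ k (L x) c)

  affine-‿ : Affine f → Affine (λ x → - f x)
  affine-‿ f-aff = affine-≗ (λ x → sym (-1*x≈-x _)) (affine-scale (- 1#) f-aff)

  affine-∘ : Affine f → Affine g → Affine (f ∘ g)
  affine-∘ {f} {g} f-aff (M , M-add , d , g≗) =
    linear f-aff ∘ M , (λ x y → trans (cong (linear f-aff) (M-add x y)) (linear-additive f-aff _ _)) ,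
    f d , λ x → begin
      f (g x)                     ≡⟨ cong f (trans (g≗ x) (+-comm (M x) d)) ⟩
      f (d + M x)                 ≡⟨ affine-shift f-aff d (M x) ⟩
      f d + linear f-aff (M x)    ≡⟨ +-comm _ _ ⟩
      linear f-aff (M x) + f d    ∎

  translation : Carrier → Carrier ↔ Carrier
  translation c = mk↔ₛ′ (_+ c) (_- c)
    (λ y → trans (+-assoc y (- c) c) (trans (cong (y +_) (-‿inverseˡ c)) (+-identityʳ y)))
    (λ x → trans (+-assoc x c (- c)) (x+[y-y]≡x x c))

  +-bijective : ∀ c → IsBijection (_+ c)
  +-bijective c = strictlyInverseᵇ⇒bijective (Inverse.strictlyInverseˡ τ) (Inverse.strictlyInverseʳ τ)
    where τ = translation c

  linear-bijective : (f-aff : Affine f) → IsBijection f → IsBijection (linear f-aff)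
  linear-bijective {f} (L , _ , c , f≗) f-bij =
    bijective-≗ L≗ (∘-bijective (+-bijective (- c)) f-bij)
    where
    L≗ : ∀ x → L x ≡ f x - c
    L≗ x = sym (trans (cong (_- c) (f≗ x)) (Inverse.strictlyInverseʳ (translation c) (L x)))

  additive-injective⇒nonzero : Additive L → Injective _≡_ _≡_ L → ∀ {x} → x ≢ 0# → L x ≢ 0#
  additive-injective⇒nonzero L-add L-inj x≢0 Lx≡0 = x≢0 (L-inj (trans Lx≡0 (sym (additive-0# L-add))))

  additive-invert : Additive L → (L-bij : IsBijection L) → Additive (invert L-bij)
  additive-invert {L} L-add L-bij x y = proj₁ L-bij (begin
    L (L⁻¹ (x + y))        ≡⟨ invert-strictlyInverseˡ L-bij (x + y) ⟩
    x + y                  ≡⟨ cong₂ _+_ (invert-strictlyInverseˡ L-bij x) (invert-strictlyInverseˡ L-bij y) ⟨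
    L (L⁻¹ x) + L (L⁻¹ y)  ≡⟨ L-add (L⁻¹ x) (L⁻¹ y) ⟨
    L (L⁻¹ x + L⁻¹ y)      ∎)
    where L⁻¹ = invert L-bij

  affine-invert : Affine f → (f-bij : IsBijection f) → Affine (invert f-bij)
  affine-invert {f} f-aff@(L , L-add , c , f≗) f-bij =
    L⁻¹ , additive-invert L-add L-bij , L⁻¹ (- c) , λ y → proj₁ f-bij (begin
      f (invert f-bij y)            ≡⟨ invert-strictlyInverseˡ f-bij y ⟩
      y                             ≡⟨ Inverse.strictlyInverseˡ (translation c) y ⟨
      y - c + c                     ≡⟨ cong₂ (λ u v → u + v + c) (invert-strictlyInverseˡ L-bij y) (invert-strictlyInverseˡ L-bij (- c)) ⟨
      L (L⁻¹ y) + L (L⁻¹ (- c)) + c ≡⟨ cong (_+ c) (L-add (L⁻¹ y) (L⁻¹ (- c))) ⟨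
      L (L⁻¹ y + L⁻¹ (- c)) + c     ≡⟨ f≗ _ ⟨
      f (L⁻¹ y + L⁻¹ (- c))         ∎)
    where
    L-bij = linear-bijective f-aff f-bij
    L⁻¹ = invert L-bij

  Δ-EA : ∀ {m₁ m₂ m₃} (m₁-aff : Affine m₁) (m₂-aff : Affine m₂) →
         (∀ x → f x ≡ m₁ (g (m₂ x)) + m₃ x) →
         ∀ a x → Δ f a x ≡ linear m₁-aff (Δ g (linear m₂-aff a) (m₂ x)) + Δ m₃ a x
  Δ-EA {f} {g} {m₁} {m₂} {m₃} m₁-aff m₂-aff f≗ a x = begin
    f (x + a) - f x
      ≡⟨ cong₂ _-_ (f≗ (x + a)) (f≗ x) ⟩
    (m₁ (g (m₂ (x + a))) + m₃ (x + a)) - (m₁ (g (m₂ x)) + m₃ x)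
      ≡⟨ [a+b]-[c+d]≡[a-c]+[b-d] _ _ _ _ ⟩
    (m₁ (g (m₂ (x + a))) - m₁ (g (m₂ x))) + Δ m₃ a x
      ≡⟨ cong (λ y → (m₁ (g y) - m₁ (g (m₂ x))) + Δ m₃ a x) (affine-shift m₂-aff x a) ⟩
    (m₁ (g (m₂ x + M₂ a)) - m₁ (g (m₂ x))) + Δ m₃ a x
      ≡⟨ cong (_+ Δ m₃ a x) (affine-sub m₁-aff _ _) ⟩
    linear m₁-aff (Δ g (M₂ a) (m₂ x)) + Δ m₃ a x
      ∎
    where M₂ = linear m₂-aff

  linear-nonzero : (f-aff : Affine f) → IsBijection f → ∀ {a} → a ≢ 0# → linear f-aff a ≢ 0#
  linear-nonzero f-aff f-bij =
    additive-injective⇒nonzero (linear-additive f-aff) (proj₁ (linear-bijective f-aff f-bij))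

  EAEquivalent-planar : EAEquivalent f g → Planar g → Planar f
  EAEquivalent-planar {f} {g} (m₁ , m₂ , m₃ , m₁-aff , m₁-bij , m₂-aff , m₂-bij , m₃-aff , f≗) g-planar a a≢0 =
    bijective-≗ (λ x → trans (Δ-EA {g = g} m₁-aff m₂-aff f≗ a x) (cong (_ +_) (affine-Δ m₃-aff a x)))
      (∘-bijective (+-bijective _)
        (∘-bijective (linear-bijective m₁-aff m₁-bij)
          (∘-bijective (g-planar (linear m₂-aff a) (linear-nonzero m₂-aff m₂-bij a≢0)) m₂-bij)))

  EAEquivalent-sym : EAEquivalent f g → EAEquivalent g f
  EAEquivalent-sym {f} {g} (m₁ , m₂ , m₃ , m₁-aff@(L₁ , L₁-add , c₁ , m₁≗) , m₁-bij , m₂-aff , m₂-bij , m₃-aff , f≗) =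
    L₁⁻¹ , m₂⁻¹ , m₃′ ,
    additive⇒affine L₁⁻¹-add , invert-bijective L₁-bij ,
    affine-invert m₂-aff m₂-bij , invert-bijective m₂-bij ,
    affine-‿ (affine-∘ (additive⇒affine L₁⁻¹-add) (affine-+ (affine-const c₁) (affine-∘ m₃-aff (affine-invert m₂-aff m₂-bij)))) ,
    g≗
    where
    L₁-bij = linear-bijective m₁-aff m₁-bij
    L₁⁻¹ = invert L₁-bij
    L₁⁻¹-add = additive-invert L₁-add L₁-bij
    m₂⁻¹ = invert m₂-bij
    shift : Carrier → Carrier
    shift y = L₁⁻¹ (c₁ + m₃ (m₂⁻¹ y))
    m₃′ : Carrier → Carrier
    m₃′ y = - shift y
    g≗ : ∀ y → g y ≡ L₁⁻¹ (f (m₂⁻¹ y)) + m₃′ y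
    g≗ y = sym (begin
      L₁⁻¹ (f (m₂⁻¹ y)) + m₃′ y
        ≡⟨ cong (λ z → L₁⁻¹ z + m₃′ y) (f≗ (m₂⁻¹ y)) ⟩
      L₁⁻¹ (m₁ (g (m₂ (m₂⁻¹ y))) + m₃ (m₂⁻¹ y)) + m₃′ y
        ≡⟨ cong (λ z → L₁⁻¹ (m₁ (g z) + m₃ (m₂⁻¹ y)) + m₃′ y) (invert-strictlyInverseˡ m₂-bij y) ⟩
      L₁⁻¹ (m₁ (g y) + m₃ (m₂⁻¹ y)) + m₃′ y
        ≡⟨ cong (λ z → L₁⁻¹ (z + m₃ (m₂⁻¹ y)) + m₃′ y) (m₁≗ (g y)) ⟩
      L₁⁻¹ ((L₁ (g y) + c₁) + m₃ (m₂⁻¹ y)) + m₃′ y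
        ≡⟨ cong (λ z → L₁⁻¹ z + m₃′ y) (+-assoc (L₁ (g y)) c₁ (m₃ (m₂⁻¹ y))) ⟩
      L₁⁻¹ (L₁ (g y) + (c₁ + m₃ (m₂⁻¹ y))) + m₃′ y
        ≡⟨ cong (_+ m₃′ y) (L₁⁻¹-add (L₁ (g y)) _) ⟩
      (L₁⁻¹ (L₁ (g y)) + shift y) - shift y
        ≡⟨ cong (λ z → (z + shift y) - shift y) (invert-strictlyInverseʳ L₁-bij (g y)) ⟩
      (g y + shift y) - shift y
        ≡⟨ Inverse.strictlyInverseʳ (translation (shift y)) (g y) ⟩
      g y ∎)

  Quadratic : (Carrier → Carrier) → Set
  Quadratic f = ∀ a → Affine (Δ f a)

  quadratic-≗ : f ≗ g → Quadratic g → Quadratic f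
  quadratic-≗ f≗g g-quad a = affine-≗ (λ x → cong₂ _-_ (f≗g (x + a)) (f≗g x)) (g-quad a)

  affine⇒quadratic : Affine f → Quadratic f
  affine⇒quadratic f-aff a = affine-≗ (affine-Δ f-aff a) (affine-const _)

  quadratic-+ : Quadratic f → Quadratic g → Quadratic (λ x → f x + g x)
  quadratic-+ f-quad g-quad a =
    affine-≗ (λ x → [a+b]-[c+d]≡[a-c]+[b-d] _ _ _ _)
             (affine-+ (f-quad a) (g-quad a))

  quadratic-scale : ∀ k → Quadratic f → Quadratic (λ x → k * f x)
  quadratic-scale k f-quad a = affine-≗ (λ x → sym (x[y-z]≈xy-xz k _ _)) (affine-scale k (f-quad a))

  quadratic-sumFin : ∀ n (f : Fin n → Carrier → Carrier) → (∀ i → Quadratic (f i)) →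
                     Quadratic (λ x → sumFin n (λ i → f i x))
  quadratic-sumFin zero    f f-quad = affine⇒quadratic (affine-const 0#)
  quadratic-sumFin (suc n) f f-quad =
    quadratic-+ (f-quad zero) (quadratic-sumFin n (f ∘ suc) (f-quad ∘ suc))

  additive-*-quadratic : ∀ {G H} → Additive G → Additive H → Quadratic (λ x → G x * H x)
  additive-*-quadratic {G} {H} G-add H-add b =
    affine-≗ Δ≗ (affine-+ (affine-+ (affine-scale (H b) (additive⇒affine G-add))
                                    (affine-scale (G b) (additive⇒affine H-add)))
                          (affine-const (G b * H b)))
    where
    Δ≗ : ∀ x → G (x + b) * H (x + b) - G x * H x ≡ (H b * G x + G b * H x) + G b * H b
    Δ≗ x = begin
      G (x + b) * H (x + b) - G x * H x
        ≡⟨ cong₂ (λ u v → u * v - G x * H x) (G-add x b) (H-add x b) ⟩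
      (G x + G b) * (H x + H b) - G x * H x
        ≡⟨ cong (_- G x * H x) (solve 4 (λ gx gb hx hb → (gx :+ gb) :* (hx :+ hb)
                     := ((hb :* gx :+ gb :* hx) :+ gb :* hb) :+ gx :* hx) refl (G x) (G b) (H x) (H b)) ⟩
      ((H b * G x + G b * H x) + G b * H b) + G x * H x - G x * H x
        ≡⟨ [x+y]-y≡x _ _ ⟩
      (H b * G x + G b * H x) + G b * H b
        ∎

  Δ-EAEquivalent : ∀ {m₁ m₂ q} → Affine m₁ → IsBijection m₁ → (m₂-aff : Affine m₂) → IsBijection m₂ →
    Quadratic q → (∀ x → f x ≡ m₁ (g (m₂ x)) + q x) →
    ∀ a → EAEquivalent (Δ f a) (Δ g (linear m₂-aff a))
  Δ-EAEquivalent {g = g} {m₂ = m₂} {q} m₁-aff m₁-bij m₂-aff m₂-bij q-quad f≗ a =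
    linear m₁-aff , m₂ , Δ q a ,
    additive⇒affine (linear-additive m₁-aff) , linear-bijective m₁-aff m₁-bij ,
    m₂-aff , m₂-bij , q-quad a ,
    Δ-EA {g = g} m₁-aff m₂-aff f≗ a

  ^≡^ᴿ : ∀ x n → x ^ n ≡ x ^ᴿ n
  ^≡^ᴿ x zero    = refl
  ^≡^ᴿ x (suc n) = cong (x *_) (^≡^ᴿ x n)

  ^-homo-* : ∀ x m n → x ^ (m Nat.+ n) ≡ x ^ m * x ^ n
  ^-homo-* x m n = begin
    x ^ (m Nat.+ n)   ≡⟨ ^≡^ᴿ x (m Nat.+ n) ⟩
    x ^ᴿ (m Nat.+ n)  ≡⟨ Exp.^-homo-* x m n ⟩
    x ^ᴿ m * x ^ᴿ n   ≡⟨ cong₂ _*_ (^≡^ᴿ x m) (^≡^ᴿ x n) ⟨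
    x ^ m * x ^ n     ∎

  _≟_ : DecidableEquality Carrier
  _≟_ = via-injection (↔⇒↣ (↔-sym enumeration)) Fin._≟_

  -- Translation by 1# permutes the elements, so adding 1# to each of them leaves their sum unchanged.
  card·1≡0 : (p Nat.^ r) · 1# ≡ 0#
  card·1≡0 = identityʳ-unique S (N · 1#) (sym (begin
    S                                 ≡⟨ sum-permute elem shift ⟩
    sum (elem ∘ Inverse.to shift)     ≡⟨ sum-cong-≗ (λ i → Inverse.strictlyInverseˡ enumeration (elem i + 1#)) ⟩
    sum (λ i → elem i + 1#)           ≡⟨ ∑-distrib-+ elem (λ _ → 1#) ⟩
    S + sum {N} (λ _ → 1#)            ≡⟨ cong (S +_) (sum-replicate N) ⟩
    S + N · 1#                        ∎))
    where
    N = p Nat.^ r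
    elem = Inverse.to enumeration
    S = sum elem
    shift : Fin N ↔ Fin N
    shift = ↔-trans enumeration (↔-trans (translation 1#) (↔-sym enumeration))

  x≢0∧x*y≡0⇒y≡0 : ∀ {x y} → x ≢ 0# → x * y ≡ 0# → y ≡ 0#
  x≢0∧x*y≡0⇒y≡0 {x} {y} x≢0 xy≡0 with inverse x x≢0
  ... | x⁻¹ , xx⁻¹≡1 = begin
    y              ≡⟨ *-identityˡ y ⟨
    1# * y         ≡⟨ cong (_* y) xx⁻¹≡1 ⟨
    (x * x⁻¹) * y  ≡⟨ cong (_* y) (*-comm x x⁻¹) ⟩
    (x⁻¹ * x) * y  ≡⟨ *-assoc x⁻¹ x y ⟩
    x⁻¹ * (x * y)  ≡⟨ cong (x⁻¹ *_) xy≡0 ⟩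
    x⁻¹ * 0#       ≡⟨ zeroʳ x⁻¹ ⟩
    0#             ∎

  ^-nonzero : ∀ {x} → x ≢ 0# → ∀ n → x ^ n ≢ 0#
  ^-nonzero x≢0 zero    1≡0   = 0≢1 (sym 1≡0)
  ^-nonzero x≢0 (suc n) xxⁿ≡0 = ^-nonzero x≢0 n (x≢0∧x*y≡0⇒y≡0 x≢0 xxⁿ≡0)

  ^·1≡·1^ : ∀ m n → (m Nat.^ n) · 1# ≡ (m · 1#) ^ n
  ^·1≡·1^ m zero    = +-identityʳ 1#
  ^·1≡·1^ m (suc n) = trans (×1-homo-* m (m Nat.^ n)) (cong ((m · 1#) *_) (^·1≡·1^ m n))

  characteristic : p · 1# ≡ 0#
  characteristic with (p · 1#) ≟ 0#
  ... | yes p·1≡0 = p·1≡0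
  ... | no  p·1≢0 = ⊥-elim (^-nonzero p·1≢0 r (trans (sym (^·1≡·1^ p r)) card·1≡0))

  frobenius-additive : Prime p → ∀ i → Additive (_^ (p Nat.^ i))
  frobenius-additive pr i x y = begin
    (x + y) ^ q          ≡⟨ ^≡^ᴿ (x + y) q ⟩
    (x + y) ^ᴿ q         ≡⟨ ^p^i-distrib-+ pr characteristic i x y ⟩
    x ^ᴿ q + y ^ᴿ q      ≡⟨ cong₂ _+_ (^≡^ᴿ x q) (^≡^ᴿ y q) ⟨
    x ^ q + y ^ q        ∎
    where
    q = p Nat.^ i
    open FreshmansDream commutativeSemiring using (^p^i-distrib-+)

  dembowskiOstrom⇒quadratic : Prime p → ∀ {d} → DembowskiOstrom d → Quadratic d
  dembowskiOstrom⇒quadratic pr (a , d≗) =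
    quadratic-≗ d≗ (quadratic-sumFin r _ λ i → quadratic-sumFin r _ λ j →
      quadratic-scale (a i j) (quadratic-≗ (λ x → ^-homo-* x (p Nat.^ toℕ i) (p Nat.^ toℕ j))
        (additive-*-quadratic (frobenius-additive pr (toℕ i)) (frobenius-additive pr (toℕ j)))))

lemma5 : (p r : ℕ) → Prime p → 1 ≤ r → (F : FiniteField p r) →
    let open FiniteField F in
    (l₁ l₂ l₃ d A : Carrier → Carrier) →
    Affine l₁ → IsBijection l₁ → Affine l₂ → IsBijection l₂ → Affine l₃ →
    DembowskiOstrom d → Alltop A →
    let A′ = λ x → l₁ (A (l₂ x)) + d x + l₃ x in
    Alltop A′ × (∀ a → a ≢ 0# → ∃ λ b → b ≢ 0# × EAEquivalent (Δ A a) (Δ A′ b))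
lemma5 p r p-prime _ F l₁ l₂ l₃ d A l₁-aff l₁-bij l₂-aff l₂-bij l₃-aff d-DO A-alltop =
  A′-alltop , ΔA-equivalent
  where
  open FiniteField F
  open FiniteFieldProperties F
  open IsCommutativeRing isCommutativeRing using (+-assoc)

  A′ E : Carrier → Carrier
  A′ x = l₁ (A (l₂ x)) + d x + l₃ x
  E x = d x + l₃ x

  E-quad : Quadratic E
  E-quad = quadratic-+ (dembowskiOstrom⇒quadratic p-prime d-DO) (affine⇒quadratic l₃-aff)

  M₂ = linear l₂-aff
  M₂-bij = linear-bijective l₂-aff l₂-bij

  ΔA′~ΔA : ∀ b → EAEquivalent (Δ A′ b) (Δ A (M₂ b))
  ΔA′~ΔA = Δ-EAEquivalent {g = A} l₁-aff l₁-bij l₂-aff l₂-bij E-quad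
             (λ x → +-assoc (l₁ (A (l₂ x))) (d x) (l₃ x))

  A′-alltop : Alltop A′
  A′-alltop b b≢0 =
    EAEquivalent-planar (ΔA′~ΔA b) (A-alltop (M₂ b) (linear-nonzero l₂-aff l₂-bij b≢0))

  ΔA-equivalent : ∀ a → a ≢ 0# → ∃ λ b → b ≢ 0# × EAEquivalent (Δ A a) (Δ A′ b)
  ΔA-equivalent a a≢0 = b , b≢0 , EAEquivalent-sym ΔA′~ΔA[b]
    where
    b = invert M₂-bij a
    b≢0 : b ≢ 0#
    b≢0 = additive-injective⇒nonzero (additive-invert (linear-additive l₂-aff) M₂-bij)
            (proj₁ (invert-bijective M₂-bij)) a≢0
    ΔA′~ΔA[b] : EAEquivalent (Δ A′ b) (Δ A a)
    ΔA′~ΔA[b] = subst (EAEquivalent (Δ A′ b) ∘ Δ A) (invert-strictlyInverseˡ M₂-bij a) (ΔA′~ΔA b)
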